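{- Let $\mathbf{L}$ be an intermediate logic, $\mathbf{LJL}_0\in\{\mathbf{LJ}_0,\mathbf{LJT}_0,\mathbf{LJ4}_0,\mathbf{LJT4}_0\}$ and $CS$ a constant specification for $\mathbf{LJL}_0$. Let $\mathsf C$ be a class of Kripke frames such that $\mathbf L$ is both strongly complete and strongly globally complete with respect to $\mathsf C$, and let $\mathsf{CKFJL}$ be the class of intuitionistic Fitting models over frames in $\mathsf C$ corresponding to $\mathbf{LJL}_0$ (all for $\mathbf{LJ}_0$; reflexive for $\mathbf{LJT}_0$; introspective for $\mathbf{LJ4}_0$; reflexive and introspective for $\mathbf{LJT4}_0$), and $\mathsf{CKFJL}_{CS}$ its subclass of models respecting $CS$. Then for any $\Gamma\cup\{\phi\}\subseteq\mathcal L_J$: $\Gamma\vdash_{\mathbf{LJL}_{CS}}\phi$ iff $\Gamma\models_{\mathsf{CKFJL}_{CS}}\phi$.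
   Context: Intermediate logic $\mathbf L\subsetneq\mathcal L_0$ (propositional language over $Var=\{p_i\}$ with $\bot,\land,\lor,\to$): contains all instances of the standard intuitionistic axiom schemes ($\phi\to(\psi\to\phi)$; $(\phi\to(\chi\to\psi))\to((\phi\to\chi)\to(\phi\to\psi))$; $(\phi\land\psi)\to\phi$; $(\phi\land\psi)\to\psi$; $\phi\to(\psi\to(\phi\land\psi))$; $\phi\to(\phi\lor\psi)$; $\psi\to(\phi\lor\psi)$; $(\phi\to\psi)\to((\chi\to\psi)\to((\phi\lor\chi)\to\psi))$; $\bot\to\phi$), closed under modus ponens and substitution; $\Gamma\vdash_{\mathbf L}\phi$ iff $\bigwedge_{i\le n}\gamma_i\to\phi\in\mathbf L$ for some $\gamma_i\in\Gamma$. Kripke frame: partial order $\langle F,\le\rangle$; propositional Kripke model: monotone $\Vdash\subseteq F\times Var$ with intuitionistic satisfaction. $\mathbf L$ strongly complete w.r.t. $\mathsf C$: $\Gamma\vdash_{\mathbf L}\phi$ iff at every world of every model over a frame in $\mathsf C$ where $\Gamma$ holds, $\phi$ holds; strongly globally complete: $\Gamma\vdash_{\mathbf L}\phi$ iff every model over a frame in $\mathsf C$ in which $\Gamma$ holds at all worlds has $\phi$ true at all worlds. Terms $Jt$: $t::=x\mid c\mid[t+t]\mid[t\cdot t]\mid\,!t$ ($x\in V=\{x_i\}$, $c\in C=\{c_i\}$); $\mathcal L_J$: $\phi::=\bot\mid p\mid\phi\land\phi\mid\phi\lor\phi\mid\phi\to\phi\mid t:\phi$. $\overline{\mathbf L}$: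 all $\sigma(\psi)$, $\psi\in\mathbf L$, $\sigma:Var\to\mathcal L_J$. Schemes $(J)$ $t:(\phi\to\psi)\to(s:\phi\to[t\cdot s]:\psi)$; $(+)$ $t:\phi\to[t+s]:\phi$, $t:\phi\to[s+t]:\phi$; $(F)$ $t:\phi\to\phi$; $(I)$ $t:\phi\to\,!t:t:\phi$. $\mathbf{LJ}_0$ = closure of $\overline{\mathbf L}\cup(J)\cup(+)$ under modus ponens; $\mathbf{LJT}_0$ adds $(F)$, $\mathbf{LJ4}_0$ adds $(I)$, $\mathbf{LJT4}_0$ both. Constant specification for $\mathbf{LJL}_0$: a set of formulas $c_{i_n}:\dots:c_{i_1}:\phi$ ($n\ge1$) with $\phi\in\overline{\mathbf L}$ or an instance of a justification scheme of $\mathbf{LJL}_0$. $\Gamma\vdash_{\mathbf{LJL}_{CS}}\phi$ iff $\bigwedge_{i\le n}\gamma_i\to\phi\in\mathbf{LJL}_0$ for some $\gamma_i\in\Gamma\cup CS$ ($n\ge 0$). An intuitionistic Fitting model over $\langle F,\le\rangle$ is $\langle F,\le,\mathcal R,\mathcal E,\Vdash\rangle$ with $\Vdash\subseteq F\times Var$, $\mathcal R\subseteq F\times F$, $\mathcal E:Jt\times F\to2^{\mathcal L_J}$ such that for $x\le y$: $x\Vdash p\Rightarrow y\Vdash p$; $\mathcal E_t(x)\subseteq\mathcal E_t(y)$; $\mathcal R[y]\subseteq\mathcal R[x]$ (where $\mathcal R[x]=\{z\mid(x,z)\in\mathcal R\}$); and $\mathcal E_t(x)\sqsupset\mathcal E_s(x)\subseteq\mathcal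 E_{[t\cdot s]}(x)$, $\mathcal E_t(x)\cup\mathcal E_s(x)\subseteq\mathcal E_{[t+s]}(x)$, with $\Gamma\sqsupset\Delta=\{\phi\mid\exists\psi:\psi\to\phi\in\Gamma,\psi\in\Delta\}$. Satisfaction: intuitionistic clauses for $\bot,p,\land,\lor,\to$ ($x\models\phi\to\psi$ iff for all $y\ge x$, $y\models\phi$ implies $y\models\psi$), and $x\models t:\phi$ iff $\phi\in\mathcal E_t(x)$ and $y\models\phi$ for all $y\in\mathcal R[x]$. Reflexive/transitive: $\mathcal R$ is; monotone: $\mathcal E_t(x)\subseteq\mathcal E_t(y)$ whenever $y\in\mathcal R[x]$; introspective: transitive, monotone and $\{t:\phi\mid\phi\in\mathcal E_t(x)\}\subseteq\mathcal E_{!t}(x)$. A model respects $CS$ if $x\models\chi$ for every world $x$ and every $\chi\in CS$. $\Gamma\models_{\mathsf K}\phi$ iff for every model in $\mathsf K$ and world $x$, if $x$ satisfies $\Gamma$ then $x\models\phi$. -}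

module Defs where

open import Data.Nat using (ℕ)
open import Data.Product using (Σ; _×_; ∃)
open import Data.Sum using (_⊎_)
open import Data.List using (List; []; _∷_)
open import Data.List.Relation.Unary.All using (All)
open import Data.Empty using (⊥)
open import Data.Unit using (⊤)
open import Relation.Nullary using (¬_)
open import Relation.Binary.PropositionalEquality using (_≡_)
open import Relation.Binary.Core using (Rel)
open import Relation.Binary.Structures using (IsPartialOrder)
open import Level using (0ℓ)

infixr 6 _∧_
infixr 5 _∨_
infixr 4 _⇒_

data Fm : Set where
  fal  : Fm
  var  : ℕ → Fm
  _∧_  : Fm → Fm → Fm
  _∨_  : Fm → Fm → Fm
  _⇒_  : Fm → Fm → Fm

subst₀ : (ℕ → Fm) → Fm → Fm
subst₀ σ fal       = fal
subst₀ σ (var i)   = σ i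
subst₀ σ (a ∧ b)   = subst₀ σ a ∧ subst₀ σ b
subst₀ σ (a ∨ b)   = subst₀ σ a ∨ subst₀ σ b
subst₀ σ (a ⇒ b)   = subst₀ σ a ⇒ subst₀ σ b

⋀₀ : List Fm → Fm
⋀₀ []       = fal ⇒ fal
⋀₀ (γ ∷ γs) = γ ∧ ⋀₀ γs

Pred₀ : Set₁
Pred₀ = Fm → Set

record IntermediateLogic : Set₁ where
  field
    L      : Pred₀
    ax1    : ∀ φ ψ → L (φ ⇒ (ψ ⇒ φ))
    ax2    : ∀ φ χ ψ → L ((φ ⇒ (χ ⇒ ψ)) ⇒ ((φ ⇒ χ) ⇒ (φ ⇒ ψ)))
    ax3    : ∀ φ ψ → L ((φ ∧ ψ) ⇒ φ)
    ax4    : ∀ φ ψ → L ((φ ∧ ψ) ⇒ ψ)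
    ax5    : ∀ φ ψ → L (φ ⇒ (ψ ⇒ (φ ∧ ψ)))
    ax6    : ∀ φ ψ → L (φ ⇒ (φ ∨ ψ))
    ax7    : ∀ φ ψ → L (ψ ⇒ (φ ∨ ψ))
    ax8    : ∀ φ ψ χ → L ((φ ⇒ ψ) ⇒ ((χ ⇒ ψ) ⇒ ((φ ∨ χ) ⇒ ψ)))
    ax9    : ∀ φ → L (fal ⇒ φ)
    MP     : ∀ φ ψ → L (φ ⇒ ψ) → L φ → L ψ
    substC : ∀ (σ : ℕ → Fm) φ → L φ → L (subst₀ σ φ)
    proper : Σ Fm (λ φ → ¬ L φ)

open IntermediateLogic public

_⊢[_]_ : Pred₀ → IntermediateLogic → Fm → Set
Γ ⊢[ 𝐋 ] φ = Σ (List Fm) (λ γs → All Γ γs × L 𝐋 (⋀₀ γs ⇒ φ))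

record Frame : Set₁ where
  field
    W     : Set
    _≤_   : Rel W 0ℓ
    isPO  : IsPartialOrder _≡_ _≤_

open Frame public

FrameClass : Set₂
FrameClass = Frame → Set₁

record Valuation (Fr : Frame) : Set₁ where
  field
    V    : W Fr → ℕ → Set
    mono : ∀ {x y} i → _≤_ Fr x y → V x i → V y i

open Valuation public

sat₀ : (Fr : Frame) → Valuation Fr → W Fr → Fm → Set
sat₀ Fr v x fal     = ⊥
sat₀ Fr v x (var i) = V v x i
sat₀ Fr v x (a ∧ b) = sat₀ Fr v x a × sat₀ Fr v x b
sat₀ Fr v x (a ∨ b) = sat₀ Fr v x a ⊎ sat₀ Fr v x b
sat₀ Fr v x (a ⇒ b) = ∀ y → _≤_ Fr x y → sat₀ Fr v y a → sat₀ Fr v y b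

LocalSem : FrameClass → Pred₀ → Fm → Set₁
LocalSem C Γ φ = ∀ (Fr : Frame) → C Fr → ∀ (v : Valuation Fr) (x : W Fr) →
  (∀ γ → Γ γ → sat₀ Fr v x γ) → sat₀ Fr v x φ

GlobalSem : FrameClass → Pred₀ → Fm → Set₁
GlobalSem C Γ φ = ∀ (Fr : Frame) → C Fr → ∀ (v : Valuation Fr) →
  (∀ γ → Γ γ → ∀ x → sat₀ Fr v x γ) → ∀ (x : W Fr) → sat₀ Fr v x φ

StronglyComplete : IntermediateLogic → FrameClass → Set₁
StronglyComplete 𝐋 C = ∀ (Γ : Pred₀) (φ : Fm) →
  (Γ ⊢[ 𝐋 ] φ → LocalSem C Γ φ) × (LocalSem C Γ φ → Γ ⊢[ 𝐋 ] φ)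

StronglyGloballyComplete : IntermediateLogic → FrameClass → Set₁
StronglyGloballyComplete 𝐋 C = ∀ (Γ : Pred₀) (φ : Fm) →
  (Γ ⊢[ 𝐋 ] φ → GlobalSem C Γ φ) × (GlobalSem C Γ φ → Γ ⊢[ 𝐋 ] φ)

infixl 7 _·_
infixl 6 _⊕_

data Tm : Set where
  tvar : ℕ → Tm
  tcon : ℕ → Tm
  _⊕_  : Tm → Tm → Tm
  _·_  : Tm → Tm → Tm
  !_   : Tm → Tm

infixr 8 _∶_
infixr 6 _∧ʲ_
infixr 5 _∨ʲ_
infixr 4 _⇒ʲ_

data JFm : Set where
  jfal  : JFm
  jvar  : ℕ → JFm
  _∧ʲ_  : JFm → JFm → JFm
  _∨ʲ_  : JFm → JFm → JFm
  _⇒ʲ_  : JFm → JFm → JFm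
  _∶_   : Tm → JFm → JFm

PredJ : Set₁
PredJ = JFm → Set

substJ : (ℕ → JFm) → Fm → JFm
substJ σ fal     = jfal
substJ σ (var i) = σ i
substJ σ (a ∧ b) = substJ σ a ∧ʲ substJ σ b
substJ σ (a ∨ b) = substJ σ a ∨ʲ substJ σ b
substJ σ (a ⇒ b) = substJ σ a ⇒ʲ substJ σ b

Lbar : IntermediateLogic → PredJ
Lbar 𝐋 φ = Σ Fm (λ ψ → Σ (ℕ → JFm) (λ σ → L 𝐋 ψ × substJ σ ψ ≡ φ))

data Variant : Set where
  LJ0 LJT0 LJ40 LJT40 : Variant

data HasF : Variant → Set where
  fT  : HasF LJT0
  fT4 : HasF LJT40

data HasI : Variant → Set where
  i4  : HasI LJ40
  iT4 : HasI LJT40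

data JAxiom (v : Variant) : JFm → Set where
  axJ  : ∀ t s φ ψ → JAxiom v (t ∶ (φ ⇒ʲ ψ) ⇒ʲ (s ∶ φ ⇒ʲ (t · s) ∶ ψ))
  axPl : ∀ t s φ → JAxiom v (t ∶ φ ⇒ʲ (t ⊕ s) ∶ φ)
  axPr : ∀ t s φ → JAxiom v (t ∶ φ ⇒ʲ (s ⊕ t) ∶ φ)
  axF  : HasF v → ∀ t φ → JAxiom v (t ∶ φ ⇒ʲ φ)
  axI  : HasI v → ∀ t φ → JAxiom v (t ∶ φ ⇒ʲ (! t) ∶ (t ∶ φ))

data LJL0 (𝐋 : IntermediateLogic) (v : Variant) : JFm → Set where
  lbar : ∀ {φ} → Lbar 𝐋 φ → LJL0 𝐋 v φ
  ax   : ∀ {φ} → JAxiom v φ → LJL0 𝐋 v φ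
  mp   : ∀ {φ ψ} → LJL0 𝐋 v (φ ⇒ʲ ψ) → LJL0 𝐋 v φ → LJL0 𝐋 v ψ

-- c_{i_n} : … : c_{i_1} : φ   (list given outermost first)
prefix : List ℕ → JFm → JFm
prefix []       φ = φ
prefix (c ∷ cs) φ = tcon c ∶ prefix cs φ

IsCS : IntermediateLogic → Variant → PredJ → Set
IsCS 𝐋 v CS = ∀ χ → CS χ →
  Σ ℕ (λ c → Σ (List ℕ) (λ cs → Σ JFm (λ φ →
    (χ ≡ prefix (c ∷ cs) φ) × (Lbar 𝐋 φ ⊎ JAxiom v φ))))

⋀ʲ : List JFm → JFm
⋀ʲ []       = jfal ⇒ʲ jfal
⋀ʲ (γ ∷ γs) = γ ∧ʲ ⋀ʲ γs

Derives : IntermediateLogic → Variant → PredJ → PredJ → JFm → Set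
Derives 𝐋 v CS Γ φ =
  Σ (List JFm) (λ γs → All (λ γ → Γ γ ⊎ CS γ) γs × LJL0 𝐋 v (⋀ʲ γs ⇒ʲ φ))

record FittingModel (Fr : Frame) : Set₁ where
  field
    V      : W Fr → ℕ → Set
    R      : W Fr → W Fr → Set
    E      : Tm → W Fr → JFm → Set
    V-mono : ∀ {x y} i → _≤_ Fr x y → V x i → V y i
    E-mono : ∀ {x y} t φ → _≤_ Fr x y → E t x φ → E t y φ
    R-anti : ∀ {x y} z → _≤_ Fr x y → R y z → R x z
    E-app  : ∀ t s x φ ψ → E t x (φ ⇒ʲ ψ) → E s x φ → E (t · s) x ψ
    E-suml : ∀ t s x φ → E t x φ → E (t ⊕ s) x φ
    E-sumr : ∀ t s x φ → E s x φ → E (t ⊕ s) x φ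

open FittingModel public

sat : (Fr : Frame) → FittingModel Fr → W Fr → JFm → Set
sat Fr M x jfal     = ⊥
sat Fr M x (jvar i) = V M x i
sat Fr M x (a ∧ʲ b) = sat Fr M x a × sat Fr M x b
sat Fr M x (a ∨ʲ b) = sat Fr M x a ⊎ sat Fr M x b
sat Fr M x (a ⇒ʲ b) = ∀ y → _≤_ Fr x y → sat Fr M y a → sat Fr M y b
sat Fr M x (t ∶ a)  = E M t x a × (∀ y → R M x y → sat Fr M y a)

Reflexive : (Fr : Frame) → FittingModel Fr → Set
Reflexive Fr M = ∀ x → R M x x

Transitive : (Fr : Frame) → FittingModel Fr → Set
Transitive Fr M = ∀ x y z → R M x y → R M y z → R M x z

MonotoneM : (Fr : Frame) → FittingModel Fr → Set
MonotoneM Fr M = ∀ t φ x y → R M x y → E M t x φ → E M t y φ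

Introspective : (Fr : Frame) → FittingModel Fr → Set
Introspective Fr M = Transitive Fr M × MonotoneM Fr M
  × (∀ t φ x → E M t x φ → E M (! t) x (t ∶ φ))

ModelFor : Variant → (Fr : Frame) → FittingModel Fr → Set
ModelFor LJ0   Fr M = ⊤
ModelFor LJT0  Fr M = Reflexive Fr M
ModelFor LJ40  Fr M = Introspective Fr M
ModelFor LJT40 Fr M = Reflexive Fr M × Introspective Fr M

Respects : (Fr : Frame) → FittingModel Fr → PredJ → Set
Respects Fr M CS = ∀ x χ → CS χ → sat Fr M x χ

Entails : FrameClass → Variant → PredJ → PredJ → JFm → Set₁
Entails C v CS Γ φ =
  ∀ (Fr : Frame) → C Fr → (M : FittingModel Fr) →
    ModelFor v Fr M → Respects Fr M CS →
    ∀ x → (∀ γ → Γ γ → sat Fr M x γ) → sat Fr M x φ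

-- Soundness: theorems of L are valid on C-frames; an instance σ(ψ) of such a
-- theorem is valid in a Fitting model because sat₀ under the valuation
-- y, i ↦ (y ⊨ σ i) agrees with sat on σ(ψ) (substitution lemma).
--
-- Completeness reduces to the strong completeness of L. Every L_J-formula is
-- "atomized" into L₀ by replacing its atoms (p_i and t : ψ) by propositional
-- variables numbered by a Gödel numbering; the decoding substitution undoes
-- this, so L-theorems about atomizations are theorems of LJL₀. Given a
-- C-frame, a valuation and a world x satisfying the atomizations of Γ, CS and
-- all LJL₀-theorems, we build a Fitting model on the same frame (E reads the
-- atoms t : ψ off the valuation above x, R is ≤ when (F) is present and empty
-- otherwise) whose truth agrees with the valuation above x. Strong (local)
-- completeness of L then yields an L-derivation from atomized premises, which
-- is converted into an LJL_CS-derivation by discharging premises one by one.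
module Submission where

open import Defs
open import Data.Nat using (ℕ; zero; suc; _+_; _<_; z≤n; s≤s) renaming (_≤_ to _≤ⁿ_)
open import Data.Nat.Properties
  using (≤-trans; ≤-<-trans; ≤-pred; m≤m+n; m≤n+m; n<1+n; +-suc; +-identityʳ)
open import Data.Product using (Σ; _×_; _,_; proj₁; proj₂; uncurry)
  renaming (map to ×-map)
open import Data.Sum using (_⊎_; inj₁; inj₂; [_,_]) renaming (map to ⊎-map)
open import Data.Empty using (⊥)
open import Data.Unit using (tt)
open import Data.List using ([]; _∷_)
open import Data.List.Relation.Unary.All as All using (All; []; _∷_)
open import Function using (id)
open import Function.Bundles using (_⇔_; mk⇔; module Equivalence)
open import Relation.Binary.Structures using (IsPartialOrder)
open import Relation.Binary.PropositionalEquality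
  using (_≡_; refl; sym; trans; cong; cong₂; module ≡-Reasoning)

open Equivalence using (to; from)

frame-refl : (Fr : Frame) {x : W Fr} → _≤_ Fr x x
frame-refl Fr = IsPartialOrder.refl (isPO Fr)

frame-trans : (Fr : Frame) {x y z : W Fr} → _≤_ Fr x y → _≤_ Fr y z → _≤_ Fr x z
frame-trans Fr = IsPartialOrder.trans (isPO Fr)

persistent₀ : ∀ Fr (val : Valuation Fr) {x y} φ →
  _≤_ Fr x y → sat₀ Fr val x φ → sat₀ Fr val y φ
persistent₀ Fr val fal     x≤y ()
persistent₀ Fr val (var i) x≤y s = mono val i x≤y s
persistent₀ Fr val (a ∧ b) x≤y (s , t) =
  persistent₀ Fr val a x≤y s , persistent₀ Fr val b x≤y t
persistent₀ Fr val (a ∨ b) x≤y (inj₁ s) = inj₁ (persistent₀ Fr val a x≤y s)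
persistent₀ Fr val (a ∨ b) x≤y (inj₂ s) = inj₂ (persistent₀ Fr val b x≤y s)
persistent₀ Fr val (a ⇒ b) x≤y f = λ z y≤z → f z (frame-trans Fr x≤y y≤z)

persistent : ∀ Fr (M : FittingModel Fr) {x y} φ →
  _≤_ Fr x y → sat Fr M x φ → sat Fr M y φ
persistent Fr M jfal     x≤y ()
persistent Fr M (jvar i) x≤y s = V-mono M i x≤y s
persistent Fr M (a ∧ʲ b) x≤y (s , t) =
  persistent Fr M a x≤y s , persistent Fr M b x≤y t
persistent Fr M (a ∨ʲ b) x≤y (inj₁ s) = inj₁ (persistent Fr M a x≤y s)
persistent Fr M (a ∨ʲ b) x≤y (inj₂ s) = inj₂ (persistent Fr M b x≤y s)
persistent Fr M (a ⇒ʲ b) x≤y f = λ z y≤z → f z (frame-trans Fr x≤y y≤z)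
persistent Fr M (t ∶ a)  x≤y (e , r) =
  E-mono M t a x≤y e , λ z y→z → r z (R-anti M z x≤y y→z)

-- Three intuitionistic tautologies used to move premises in and out of the
-- antecedent of a derivation: currying, uncurrying and exchange.
curry-valid : ∀ (A B C : Fm) Fr val x →
  sat₀ Fr val x (((A ∧ B) ⇒ C) ⇒ (B ⇒ (A ⇒ C)))
curry-valid A B C Fr val x y _ f z y≤z b w z≤w a =
  f w (frame-trans Fr y≤z z≤w) (a , persistent₀ Fr val B z≤w b)

uncurry-valid : ∀ (D A C : Fm) Fr val x →
  sat₀ Fr val x ((D ⇒ (A ⇒ C)) ⇒ ((A ∧ D) ⇒ C))
uncurry-valid D A C Fr val x y _ f z y≤z (a , d) = f z y≤z d z (frame-refl Fr) a

exchange-valid : ∀ (D A C : Fm) Fr val x →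
  sat₀ Fr val x ((D ⇒ (A ⇒ C)) ⇒ (A ⇒ (D ⇒ C)))
exchange-valid D A C Fr val x y _ f z y≤z a w z≤w d =
  f w (frame-trans Fr y≤z z≤w) d w (frame-refl Fr) (persistent₀ Fr val A z≤w a)

-- Cantor pairing ℕ × ℕ → ℕ, with the inverse given by enumerating the
-- anti-diagonals; tri d = 0 + 1 + ⋯ + d counts the points before diagonal d.
tri : ℕ → ℕ
tri zero    = zero
tri (suc d) = suc d + tri d

pair : ℕ → ℕ → ℕ
pair a b = a + tri (a + b)

-- Successor in the enumeration (0,0), (0,1), (1,0), (0,2), (1,1), (2,0), …
next : ℕ × ℕ → ℕ × ℕ
next (a , zero)  = zero , suc a
next (a , suc b) = suc a , b

unpair : ℕ → ℕ × ℕ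
unpair zero    = 0 , 0
unpair (suc n) = next (unpair n)

pair-next : ∀ p → uncurry pair (next p) ≡ suc (uncurry pair p)
pair-next (a , zero)  = cong (λ k → suc (a + tri k)) (sym (+-identityʳ a))
pair-next (a , suc b) = cong (λ k → suc (a + tri k)) (sym (+-suc a b))

pair-unpair : ∀ n → uncurry pair (unpair n) ≡ n
pair-unpair zero    = refl
pair-unpair (suc n) = trans (pair-next (unpair n)) (cong suc (pair-unpair n))

unpair-along-diagonal : ∀ k b m → unpair m ≡ (0 , k + b) → unpair (k + m) ≡ (k , b)
unpair-along-diagonal zero    b m start = start
unpair-along-diagonal (suc k) b m start =
  cong next (unpair-along-diagonal k (suc b) m
    (trans start (cong (0 ,_) (sym (+-suc k b)))))

unpair-diagonal-start : ∀ d → Σ ℕ (λ m → unpair m ≡ (0 , d))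
unpair-diagonal-start zero    = 0 , refl
unpair-diagonal-start (suc d) with unpair-diagonal-start d
... | m , start = suc (d + m) , cong next
  (unpair-along-diagonal d 0 m (trans start (cong (0 ,_) (sym (+-identityʳ d)))))

unpair-surjective : ∀ a b → Σ ℕ (λ n → unpair n ≡ (a , b))
unpair-surjective a b with unpair-diagonal-start (a + b)
... | m , start = a + m , unpair-along-diagonal a b m start

-- Since pair ∘ unpair = id and unpair is onto, unpair ∘ pair = id.
unpair-pair : ∀ a b → unpair (pair a b) ≡ (a , b)
unpair-pair a b with unpair-surjective a b
... | n , hit = begin
    unpair (pair a b)                ≡⟨ cong (λ p → unpair (uncurry pair p)) (sym hit) ⟩
    unpair (uncurry pair (unpair n)) ≡⟨ cong unpair (pair-unpair n) ⟩
    unpair n                         ≡⟨ hit ⟩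
    (a , b)                          ∎
  where open ≡-Reasoning

n≤tri : ∀ n → n ≤ⁿ tri n
n≤tri zero    = z≤n
n≤tri (suc d) = m≤m+n (suc d) (tri d)

pair-≥₁ : ∀ a b → a ≤ⁿ pair a b
pair-≥₁ a b = m≤m+n a _

pair-≥₂ : ∀ a b → b ≤ⁿ pair a b
pair-≥₂ a b = ≤-trans (m≤n+m b a) (≤-trans (n≤tri (a + b)) (m≤n+m _ a))

pair-tagged> : ∀ k b → b < pair (suc k) b
pair-tagged> k b =
  ≤-trans (s≤s (m≤n+m b k)) (≤-trans (n≤tri (suc k + b)) (m≤n+m _ (suc k)))

payload< : ∀ k b {f} → pair (suc k) b < suc f → b < f
payload< k b lt = ≤-trans (pair-tagged> k b) (≤-pred lt)

component₁< : ∀ k a b {f} → pair (suc k) (pair a b) < suc f → a < f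
component₁< k a b lt = ≤-<-trans (pair-≥₁ a b) (payload< k (pair a b) lt)

component₂< : ∀ k a b {f} → pair (suc k) (pair a b) < suc f → b < f
component₂< k a b lt = ≤-<-trans (pair-≥₂ a b) (payload< k (pair a b) lt)

tag-correct : {X : Set} (layer : ℕ × ℕ → X) (k n : ℕ) →
  layer (unpair (pair k n)) ≡ layer (k , n)
tag-correct layer k n = cong layer (unpair-pair k n)

node : {A B X : Set} → (A → B → X) → (ℕ → A) → (ℕ → B) → ℕ → X
node f da db n = f (da (proj₁ (unpair n))) (db (proj₂ (unpair n)))

node-correct : {A B X : Set} (f : A → B → X) (da : ℕ → A) (db : ℕ → B)
  {m n : ℕ} {a : A} {b : B} →
  da m ≡ a → db n ≡ b → node f da db (pair m n) ≡ f a b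
node-correct f da db {m} {n} p q =
  trans (cong (λ c → f (da (proj₁ c)) (db (proj₂ c))) (unpair-pair m n)) (cong₂ f p q)

encodeTm : Tm → ℕ
encodeTm (tvar i) = pair 0 i
encodeTm (tcon i) = pair 1 i
encodeTm (t ⊕ s)  = pair 2 (pair (encodeTm t) (encodeTm s))
encodeTm (t · s)  = pair 3 (pair (encodeTm t) (encodeTm s))
encodeTm (! t)    = pair 4 (encodeTm t)

decodeTm-layer : (ℕ → Tm) → ℕ × ℕ → Tm
decodeTm-layer d (0 , i) = tvar i
decodeTm-layer d (1 , i) = tcon i
decodeTm-layer d (2 , n) = node _⊕_ d d n
decodeTm-layer d (3 , n) = node _·_ d d n
decodeTm-layer d (4 , n) = ! d n
decodeTm-layer d (_ , _) = tvar 0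

decodeTm : (fuel : ℕ) → ℕ → Tm
decodeTm zero    n = tvar 0
decodeTm (suc f) n = decodeTm-layer (decodeTm f) (unpair n)

decodeTm-correct : ∀ t f → encodeTm t < f → decodeTm f (encodeTm t) ≡ t
decodeTm-correct (tvar i) (suc f) lt = tag-correct (decodeTm-layer (decodeTm f)) 0 i
decodeTm-correct (tcon i) (suc f) lt = tag-correct (decodeTm-layer (decodeTm f)) 1 i
decodeTm-correct (t ⊕ s)  (suc f) lt =
  trans (tag-correct (decodeTm-layer (decodeTm f)) 2 (pair (encodeTm t) (encodeTm s)))
        (node-correct _⊕_ (decodeTm f) (decodeTm f)
          (decodeTm-correct t f (component₁< 1 (encodeTm t) (encodeTm s) lt))
          (decodeTm-correct s f (component₂< 1 (encodeTm t) (encodeTm s) lt)))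
decodeTm-correct (t · s)  (suc f) lt =
  trans (tag-correct (decodeTm-layer (decodeTm f)) 3 (pair (encodeTm t) (encodeTm s)))
        (node-correct _·_ (decodeTm f) (decodeTm f)
          (decodeTm-correct t f (component₁< 2 (encodeTm t) (encodeTm s) lt))
          (decodeTm-correct s f (component₂< 2 (encodeTm t) (encodeTm s) lt)))
decodeTm-correct (! t)    (suc f) lt =
  trans (tag-correct (decodeTm-layer (decodeTm f)) 4 (encodeTm t))
        (cong !_ (decodeTm-correct t f (payload< 3 (encodeTm t) lt)))

encode : JFm → ℕ
encode jfal     = pair 0 0
encode (jvar i) = pair 1 i
encode (a ∧ʲ b) = pair 2 (pair (encode a) (encode b))
encode (a ∨ʲ b) = pair 3 (pair (encode a) (encode b))
encode (a ⇒ʲ b) = pair 4 (pair (encode a) (encode b))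
encode (t ∶ a)  = pair 5 (pair (encodeTm t) (encode a))

decodeFm-layer : (ℕ → JFm) → (ℕ → Tm) → ℕ × ℕ → JFm
decodeFm-layer d dt (0 , _) = jfal
decodeFm-layer d dt (1 , i) = jvar i
decodeFm-layer d dt (2 , n) = node _∧ʲ_ d d n
decodeFm-layer d dt (3 , n) = node _∨ʲ_ d d n
decodeFm-layer d dt (4 , n) = node _⇒ʲ_ d d n
decodeFm-layer d dt (5 , n) = node _∶_ dt d n
decodeFm-layer d dt (_ , _) = jfal

decodeFm : (fuel : ℕ) → ℕ → JFm
decodeFm zero    n = jfal
decodeFm (suc f) n = decodeFm-layer (decodeFm f) (decodeTm f) (unpair n)

decodeFm-correct : ∀ χ f → encode χ < f → decodeFm f (encode χ) ≡ χ
decodeFm-correct jfal     (suc f) lt = tag-correct (decodeFm-layer (decodeFm f) (decodeTm f)) 0 0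
decodeFm-correct (jvar i) (suc f) lt = tag-correct (decodeFm-layer (decodeFm f) (decodeTm f)) 1 i
decodeFm-correct (a ∧ʲ b) (suc f) lt =
  trans (tag-correct (decodeFm-layer (decodeFm f) (decodeTm f)) 2 (pair (encode a) (encode b)))
        (node-correct _∧ʲ_ (decodeFm f) (decodeFm f)
          (decodeFm-correct a f (component₁< 1 (encode a) (encode b) lt))
          (decodeFm-correct b f (component₂< 1 (encode a) (encode b) lt)))
decodeFm-correct (a ∨ʲ b) (suc f) lt =
  trans (tag-correct (decodeFm-layer (decodeFm f) (decodeTm f)) 3 (pair (encode a) (encode b)))
        (node-correct _∨ʲ_ (decodeFm f) (decodeFm f)
          (decodeFm-correct a f (component₁< 2 (encode a) (encode b) lt))
          (decodeFm-correct b f (component₂< 2 (encode a) (encode b) lt)))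
decodeFm-correct (a ⇒ʲ b) (suc f) lt =
  trans (tag-correct (decodeFm-layer (decodeFm f) (decodeTm f)) 4 (pair (encode a) (encode b)))
        (node-correct _⇒ʲ_ (decodeFm f) (decodeFm f)
          (decodeFm-correct a f (component₁< 3 (encode a) (encode b) lt))
          (decodeFm-correct b f (component₂< 3 (encode a) (encode b) lt)))
decodeFm-correct (t ∶ a)  (suc f) lt =
  trans (tag-correct (decodeFm-layer (decodeFm f) (decodeTm f)) 5 (pair (encodeTm t) (encode a)))
        (node-correct _∶_ (decodeTm f) (decodeFm f)
          (decodeTm-correct t f (component₁< 4 (encodeTm t) (encode a) lt))
          (decodeFm-correct a f (component₂< 4 (encodeTm t) (encode a) lt)))

-- Every code is smaller than its successor, which is therefore enough fuel.
decode : ℕ → JFm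
decode n = decodeFm (suc n) n

decode-encode : ∀ χ → decode (encode χ) ≡ χ
decode-encode χ = decodeFm-correct χ _ (n<1+n (encode χ))

atomize : JFm → Fm
atomize jfal     = fal
atomize (jvar i) = var (encode (jvar i))
atomize (a ∧ʲ b) = atomize a ∧ atomize b
atomize (a ∨ʲ b) = atomize a ∨ atomize b
atomize (a ⇒ʲ b) = atomize a ⇒ atomize b
atomize (t ∶ a)  = var (encode (t ∶ a))

decode-atomize : ∀ χ → substJ decode (atomize χ) ≡ χ
decode-atomize jfal     = refl
decode-atomize (jvar i) = decode-encode (jvar i)
decode-atomize (a ∧ʲ b) = cong₂ _∧ʲ_ (decode-atomize a) (decode-atomize b)
decode-atomize (a ∨ʲ b) = cong₂ _∨ʲ_ (decode-atomize a) (decode-atomize b)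
decode-atomize (a ⇒ʲ b) = cong₂ _⇒ʲ_ (decode-atomize a) (decode-atomize b)
decode-atomize (t ∶ a)  = decode-encode (t ∶ a)

induced : ∀ Fr → FittingModel Fr → (ℕ → JFm) → Valuation Fr
induced Fr M σ = record
  { V    = λ y i → sat Fr M y (σ i)
  ; mono = λ i → persistent Fr M (σ i) }

substitution-lemma : ∀ Fr M σ ψ y →
  sat₀ Fr (induced Fr M σ) y ψ ⇔ sat Fr M y (substJ σ ψ)
substitution-lemma Fr M σ fal     y = mk⇔ id id
substitution-lemma Fr M σ (var i) y = mk⇔ id id
substitution-lemma Fr M σ (a ∧ b) y =
  mk⇔ (×-map (to (substitution-lemma Fr M σ a y)) (to (substitution-lemma Fr M σ b y)))
      (×-map (from (substitution-lemma Fr M σ a y)) (from (substitution-lemma Fr M σ b y)))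
substitution-lemma Fr M σ (a ∨ b) y =
  mk⇔ (⊎-map (to (substitution-lemma Fr M σ a y)) (to (substitution-lemma Fr M σ b y)))
      (⊎-map (from (substitution-lemma Fr M σ a y)) (from (substitution-lemma Fr M σ b y)))
substitution-lemma Fr M σ (a ⇒ b) y =
  mk⇔ (λ f z y≤z s → to (substitution-lemma Fr M σ b z)
                          (f z y≤z (from (substitution-lemma Fr M σ a z) s)))
      (λ f z y≤z s → from (substitution-lemma Fr M σ b z)
                          (f z y≤z (to (substitution-lemma Fr M σ a z) s)))

reflexive-of : ∀ {v Fr M} → HasF v → ModelFor v Fr M → Reflexive Fr M
reflexive-of fT  r       = r
reflexive-of fT4 (r , _) = r

introspective-of : ∀ {v Fr M} → HasI v → ModelFor v Fr M → Introspective Fr M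
introspective-of i4  i       = i
introspective-of iT4 (_ , i) = i

model-for : ∀ v {Fr} (M : FittingModel Fr) →
  (HasF v → Reflexive Fr M) → (HasI v → Introspective Fr M) → ModelFor v Fr M
model-for LJ0   M r i = tt
model-for LJT0  M r i = r fT
model-for LJ40  M r i = i i4
model-for LJT40 M r i = r fT4 , i iT4

axiom-valid : ∀ {v} Fr (M : FittingModel Fr) → ModelFor v Fr M →
  ∀ {χ} → JAxiom v χ → ∀ y → sat Fr M y χ
axiom-valid Fr M m (axJ t s φ ψ) y z _ (e₁ , r₁) w z≤w (e₂ , r₂) =
  E-app M t s w φ ψ (E-mono M t (φ ⇒ʲ ψ) z≤w e₁) e₂ ,
  λ u w→u → r₁ u (R-anti M u z≤w w→u) u (frame-refl Fr) (r₂ u w→u)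
axiom-valid Fr M m (axPl t s φ) y z _ (e , r) = E-suml M t s z φ e , r
axiom-valid Fr M m (axPr t s φ) y z _ (e , r) = E-sumr M s t z φ e , r
axiom-valid Fr M m (axF f t φ)  y z _ (e , r) = r z (reflexive-of f m z)
axiom-valid Fr M m (axI i t φ)  y z _ (e , r) with introspective-of i m
... | R-trans , E-R-mono , E-intro =
  E-intro t φ z e , λ u z→u → E-R-mono t φ z u z→u e , λ w u→w → r w (R-trans z u w z→u u→w)

conjunction-sat : ∀ Fr M x γs → All (sat Fr M x) γs → sat Fr M x (⋀ʲ γs)
conjunction-sat Fr M x []       []       = λ _ _ ()
conjunction-sat Fr M x (γ ∷ γs) (s ∷ ss) = s , conjunction-sat Fr M x γs ss

module _ (𝐋 : IntermediateLogic) (C : FrameClass) (sc : StronglyComplete 𝐋 C) where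

  ∅ : Pred₀
  ∅ _ = ⊥

  -- Theorems of L are valid on every frame of C (strong completeness, Γ = ∅).
  L-valid : ∀ {ψ} → L 𝐋 ψ → ∀ Fr → C Fr → ∀ val x → sat₀ Fr val x ψ
  L-valid {ψ} Lψ Fr CFr val x =
    proj₁ (sc ∅ ψ) ([] , [] , MP 𝐋 _ _ (ax1 𝐋 ψ (⋀₀ [])) Lψ) Fr CFr val x (λ _ ())

  -- Formulas valid on all frames belong to L (strong completeness, Γ = ∅).
  valid-in-L : ∀ θ → (∀ Fr val x → sat₀ Fr val x θ) → L 𝐋 θ
  valid-in-L θ valid with proj₂ (sc ∅ θ) (λ Fr _ val x _ → valid Fr val x)
  ... | []    , []       , p = MP 𝐋 _ _ p (ax9 𝐋 fal)
  ... | _ ∷ _ , () ∷ _   , _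

  LJL0-valid : ∀ {v Fr} → C Fr → (M : FittingModel Fr) → ModelFor v Fr M →
    ∀ {χ} → LJL0 𝐋 v χ → ∀ y → sat Fr M y χ
  LJL0-valid {Fr = Fr} CFr M m (lbar (ψ , σ , Lψ , refl)) y =
    to (substitution-lemma Fr M σ ψ y) (L-valid Lψ Fr CFr (induced Fr M σ) y)
  LJL0-valid {Fr = Fr} CFr M m (ax a) y = axiom-valid Fr M m a y
  LJL0-valid {Fr = Fr} CFr M m (mp p q) y =
    LJL0-valid CFr M m p y y (frame-refl Fr) (LJL0-valid CFr M m q y)

  soundness : ∀ v CS Γ φ → Derives 𝐋 v CS Γ φ → Entails C v CS Γ φ
  soundness v CS Γ φ (γs , premises , p) Fr CFr M m respects x Γ-holds =
    LJL0-valid CFr M m p x x (frame-refl Fr)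
      (conjunction-sat Fr M x γs (All.map [ Γ-holds _ , respects x _ ] premises))

  atomized-theorem : ∀ {v} χ → L 𝐋 (atomize χ) → LJL0 𝐋 v χ
  atomized-theorem χ p = lbar (atomize χ , decode , p , decode-atomize χ)

  atomized-tautology : ∀ {v} χ → (∀ Fr val x → sat₀ Fr val x (atomize χ)) → LJL0 𝐋 v χ
  atomized-tautology χ valid = atomized-theorem χ (valid-in-L (atomize χ) valid)

  use-premise : ∀ {v CS Γ χ ψ} → Γ χ ⊎ CS χ →
    Derives 𝐋 v CS Γ (χ ⇒ʲ ψ) → Derives 𝐋 v CS Γ ψ
  use-premise {χ = χ} {ψ} premise (δs , premises , p) =
    χ ∷ δs , premise ∷ premises ,
    mp (atomized-tautology ((⋀ʲ δs ⇒ʲ (χ ⇒ʲ ψ)) ⇒ʲ ((χ ∧ʲ ⋀ʲ δs) ⇒ʲ ψ))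
         (uncurry-valid (atomize (⋀ʲ δs)) (atomize χ) (atomize ψ))) p

  use-theorem : ∀ {v CS Γ χ ψ} → LJL0 𝐋 v χ →
    Derives 𝐋 v CS Γ (χ ⇒ʲ ψ) → Derives 𝐋 v CS Γ ψ
  use-theorem {χ = χ} {ψ} theorem (δs , premises , p) =
    δs , premises ,
    mp (mp (atomized-tautology ((⋀ʲ δs ⇒ʲ (χ ⇒ʲ ψ)) ⇒ʲ (χ ⇒ʲ (⋀ʲ δs ⇒ʲ ψ)))
             (exchange-valid (atomize (⋀ʲ δs)) (atomize χ) (atomize ψ))) p) theorem

  discharge : ∀ {v CS Γ χ ψ} → (Γ χ ⊎ CS χ) ⊎ LJL0 𝐋 v χ →
    Derives 𝐋 v CS Γ (χ ⇒ʲ ψ) → Derives 𝐋 v CS Γ ψ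
  discharge (inj₁ premise) = use-premise premise
  discharge (inj₂ theorem) = use-theorem theorem

  Premises : Variant → PredJ → PredJ → Pred₀
  Premises v CS Γ θ = Σ JFm λ χ → ((Γ χ ⊎ CS χ) ⊎ LJL0 𝐋 v χ) × atomize χ ≡ θ

  extract : ∀ {v CS Γ} γs → All (Premises v CS Γ) γs →
    ∀ ψ → L 𝐋 (⋀₀ γs ⇒ atomize ψ) → Derives 𝐋 v CS Γ ψ
  extract []       []                                ψ p =
    [] , [] , atomized-theorem (⋀ʲ [] ⇒ʲ ψ) p
  extract (_ ∷ γs) ((χ , origin , refl) ∷ premises) ψ p =
    discharge origin
      (extract γs premises (χ ⇒ʲ ψ)
        (MP 𝐋 _ _ (valid-in-L _ (curry-valid (atomize χ) (⋀₀ γs) (atomize ψ))) p))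

  module Canonical (v : Variant) (CS : PredJ) (isCS : IsCS 𝐋 v CS) (Γ : PredJ)
    (Fr : Frame) (CFr : C Fr) (val : Valuation Fr) (x : W Fr)
    (premises-hold : ∀ θ → Premises v CS Γ θ → sat₀ Fr val x θ) where

    _⊑_ : W Fr → W Fr → Set
    _⊑_ = _≤_ Fr

    premise-above : ∀ {χ z} → (Γ χ ⊎ CS χ) ⊎ LJL0 𝐋 v χ → x ⊑ z → sat₀ Fr val z (atomize χ)
    premise-above {χ} origin x⊑z =
      persistent₀ Fr val (atomize χ) x⊑z (premises-hold _ (χ , origin , refl))

    axiom-above : ∀ {χ ψ z} → JAxiom v (χ ⇒ʲ ψ) → x ⊑ z →
      sat₀ Fr val z (atomize χ) → sat₀ Fr val z (atomize ψ)
    axiom-above a x⊑z = premise-above (inj₂ (ax a)) x⊑z _ (frame-refl Fr)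

    E-canonical : Tm → W Fr → JFm → Set
    E-canonical t y ψ = ∀ z → y ⊑ z → x ⊑ z → sat₀ Fr val z (atomize (t ∶ ψ))

    M : FittingModel Fr
    M = record
      { V      = λ y i → Valuation.V val y (encode (jvar i))
      ; R      = λ y z → HasF v × y ⊑ z
      ; E      = E-canonical
      ; V-mono = λ i → mono val (encode (jvar i))
      ; E-mono = λ t φ y⊑y′ e z y′⊑z → e z (frame-trans Fr y⊑y′ y′⊑z)
      ; R-anti = λ z y⊑y′ (f , y′⊑z) → f , frame-trans Fr y⊑y′ y′⊑z
      ; E-app  = λ t s y φ ψ e₁ e₂ z y⊑z x⊑z →
          axiom-above (axJ t s φ ψ) x⊑z (e₁ z y⊑z x⊑z) z (frame-refl Fr) (e₂ z y⊑z x⊑z)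
      ; E-suml = λ t s y φ e z y⊑z x⊑z → axiom-above (axPl t s φ) x⊑z (e z y⊑z x⊑z)
      ; E-sumr = λ t s y φ e z y⊑z x⊑z → axiom-above (axPr s t φ) x⊑z (e z y⊑z x⊑z)
      }

    truth : ∀ χ {y} → x ⊑ y → sat Fr M y χ ⇔ sat₀ Fr val y (atomize χ)
    truth jfal     x⊑y = mk⇔ id id
    truth (jvar i) x⊑y = mk⇔ id id
    truth (a ∧ʲ b) x⊑y =
      mk⇔ (×-map (to (truth a x⊑y)) (to (truth b x⊑y)))
          (×-map (from (truth a x⊑y)) (from (truth b x⊑y)))
    truth (a ∨ʲ b) x⊑y =
      mk⇔ (⊎-map (to (truth a x⊑y)) (to (truth b x⊑y)))
          (⊎-map (from (truth a x⊑y)) (from (truth b x⊑y)))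
    truth (a ⇒ʲ b) x⊑y =
      mk⇔ (λ f z y⊑z s → to (truth b (x⊑ z y⊑z)) (f z y⊑z (from (truth a (x⊑ z y⊑z)) s)))
          (λ f z y⊑z s → from (truth b (x⊑ z y⊑z)) (f z y⊑z (to (truth a (x⊑ z y⊑z)) s)))
      where x⊑ : ∀ z → _ ⊑ z → x ⊑ z
            x⊑ z y⊑z = frame-trans Fr x⊑y y⊑z
    truth (t ∶ ψ) {y} x⊑y =
      mk⇔ (λ (e , _) → e y (frame-refl Fr) x⊑y)
          (λ s → (λ z y⊑z _ → persistent₀ Fr val (atomize (t ∶ ψ)) y⊑z s) ,
                 λ z (f , y⊑z) → from (truth ψ (frame-trans Fr x⊑y y⊑z))
                   (axiom-above (axF f t ψ) (frame-trans Fr x⊑y y⊑z)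
                     (persistent₀ Fr val (atomize (t ∶ ψ)) y⊑z s)))

    is-model-for : ModelFor v Fr M
    is-model-for = model-for v M
      (λ f y → f , frame-refl Fr)
      (λ i → (λ _ _ _ (f , y⊑z) (_ , z⊑w) → f , frame-trans Fr y⊑z z⊑w) ,
             (λ t φ y z (_ , y⊑z) → E-mono M t φ y⊑z) ,
             (λ t φ y e z y⊑z x⊑z → axiom-above (axI i t φ) x⊑z (e z y⊑z x⊑z)))

    -- c_n : … : c_1 : φ for a theorem φ holds everywhere in M as soon as its
    -- atomization holds above x; each (F)-step of R strips one constant.
    prefix-sat : ∀ cs {φ} → LJL0 𝐋 v φ →
      (∀ {z} → x ⊑ z → sat₀ Fr val z (atomize (prefix cs φ))) → ∀ y → sat Fr M y (prefix cs φ)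
    prefix-sat []       theorem _ y = LJL0-valid CFr M is-model-for theorem y
    prefix-sat (c ∷ cs) {φ} theorem above y =
      (λ z _ x⊑z → above x⊑z) ,
      λ z (f , _) → prefix-sat cs theorem
        (λ x⊑w → axiom-above (axF f (tcon c) (prefix cs φ)) x⊑w (above x⊑w)) z

    respects : Respects Fr M CS
    respects y χ χ∈CS with isCS χ χ∈CS
    ... | c , cs , φ , refl , origin =
      prefix-sat (c ∷ cs) ([ lbar , ax ] origin) (premise-above (inj₁ (inj₂ χ∈CS))) y

  completeness : ∀ v CS → IsCS 𝐋 v CS → ∀ Γ φ → Entails C v CS Γ φ → Derives 𝐋 v CS Γ φ
  completeness v CS isCS Γ φ entails
    with proj₂ (sc (Premises v CS Γ) (atomize φ)) atomized-consequence
    where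
    atomized-consequence : LocalSem C (Premises v CS Γ) (atomize φ)
    atomized-consequence Fr CFr val x premises-hold =
      to (truth φ (frame-refl Fr))
        (entails Fr CFr M is-model-for respects x
          (λ γ Γγ → from (truth γ (frame-refl Fr)) (premise-above (inj₁ (inj₁ Γγ)) (frame-refl Fr))))
      where open Canonical v CS isCS Γ Fr CFr val x premises-hold
  ... | γs , premises , p = extract γs premises φ p

mainTheorem6 : (𝐋 : IntermediateLogic) (v : Variant) (CS : PredJ) → IsCS 𝐋 v CS →
    (C : FrameClass) → StronglyComplete 𝐋 C → StronglyGloballyComplete 𝐋 C →
    (Γ : PredJ) (φ : JFm) →
    (Derives 𝐋 v CS Γ φ → Entails C v CS Γ φ) × (Entails C v CS Γ φ → Derives 𝐋 v CS Γ φ)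
mainTheorem6 𝐋 v CS isCS C sc _ Γ φ =
  soundness 𝐋 C sc v CS Γ φ , completeness 𝐋 C sc v CS isCS Γ φ
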